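{- Let $G$ be a finite abelian group of order $n$, let $L$ be a $d$-dimensional Latin hypercube of order $n$ indexed by $G$, let $d'>d$, and let $L'$ be the $d'$-dimensional $G$-extension of $L$. Then an entry $\alpha$ of $L'$ is contained in a transversal of $L'$ if and only if $\pi(\alpha)$ is contained in a $(G,d')$-suitable diagonal of $L$.
   Context: A $d$-dimensional hypercube of order $n$ indexed by $G$ ($|G|=n$) is a map $H:G^d\to G$; its entries are $(x_1,\dots,x_d;H(x_1,\dots,x_d))$. A line is obtained by fixing all but one coordinate and a hyperplane by fixing one coordinate; $H$ is Latin if every line contains every element of $G$ as a symbol. A diagonal is a set of $n$ entries no two of which agree in any coordinate; a transversal is a diagonal with pairwise distinct symbols. For an entry $e=(x_1,\dots,x_d;\sigma)$ define $\Delta(e)=\sigma-x_1-\cdots-x_d\in G$. Let $G_+$ denote the sum of all elements of $G$. A diagonal $D$ of a $d$-dimensional Latin hypercube indexed by $G$ is $(G,d')$-suitable if $\sum_{e\in D}\Delta(e)=(1-d')G_+$. For $d'>d$, the $d'$-dimensional $G$-extension of $L$ is the Latin hypercube $L'$ given by $L'(x_1,\dots,x_{d'})=L(x_1,\dots,x_d)+\sum_{i=d+1}^{d'}x_i$, and $\pi:L'\to L$ is the map sending the entry $(x_1,\dots,x_{d'};L'(x_1,\dots,x_{d'}))$ to $(x_1,\dots,x_d;L(x_1,\dots,x_d))$. -}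

module Defs where

open import Level using (Level; _⊔_)
open import Algebra.Bundles using (AbelianGroup)
open import Data.Nat using (ℕ; zero; suc; _≤_; _<_; _≤?_)
open import Data.Nat.Properties using (<⇒≤)
open import Data.Fin using (Fin; toℕ; inject≤; _≟_)
open import Data.Bool using (if_then_else_)
open import Data.Product using (Σ; ∃; _×_; _,_)
open import Relation.Nullary.Decidable using (⌊_⌋)
open import Relation.Binary.PropositionalEquality using (_≡_)

record HasOrder {c ℓ : Level} (G : AbelianGroup c ℓ) (n : ℕ) : Set (c ⊔ ℓ) where
  open AbelianGroup G
  field
    enum      : Fin n → Carrier
    enum-inj  : ∀ k l → enum k ≈ enum l → k ≡ l
    enum-surj : ∀ g → ∃ λ k → enum k ≈ g

module Hyper {c ℓ : Level} (G : AbelianGroup c ℓ) {n : ℕ} (ord : HasOrder G n) where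
  open AbelianGroup G
  open HasOrder ord

  sumFin : (m : ℕ) → (Fin m → Carrier) → Carrier
  sumFin zero    f = ε
  sumFin (suc m) f = f Fin.zero ∙ sumFin m (λ i → f (Fin.suc i))

  mulℕ : ℕ → Carrier → Carrier
  mulℕ zero    g = ε
  mulℕ (suc m) g = g ∙ mulℕ m g

  G₊ : Carrier
  G₊ = sumFin n enum

  oneMinus·G₊ : ℕ → Carrier
  oneMinus·G₊ d' = G₊ ∙ (mulℕ d' G₊) ⁻¹

  Point : ℕ → Set c
  Point d = Fin d → Carrier

  Hypercube : ℕ → Set c
  Hypercube d = Point d → Carrier

  Respects≈ : {d : ℕ} → Hypercube d → Set (c ⊔ ℓ)
  Respects≈ {d} H = ∀ (x y : Point d) → (∀ i → x i ≈ y i) → H x ≈ H y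

  update : {d : ℕ} → Point d → Fin d → Carrier → Point d
  update x i g j = if ⌊ j ≟ i ⌋ then g else x j

  IsLatin : {d : ℕ} → Hypercube d → Set (c ⊔ ℓ)
  IsLatin {d} H = ∀ (x : Point d) (i : Fin d) (s : Carrier) →
                  ∃ λ g → H (update x i g) ≈ s

  Δ : {d : ℕ} → Hypercube d → Point d → Carrier
  Δ {d} H x = H x ∙ (sumFin d x) ⁻¹

  -- a diagonal: n pairwise distinct entries, no two agreeing in any coordinate
  -- (an entry is determined by its coordinates, its symbol being H x)
  record Diagonal {d : ℕ} (H : Hypercube d) : Set (c ⊔ ℓ) where
    field
      pt        : Fin n → Point d
      distinct  : ∀ k l → (∀ i → pt k i ≈ pt l i) → k ≡ l
      coord-inj : ∀ (i : Fin d) k l → pt k i ≈ pt l i → k ≡ l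

  _∈D_ : {d : ℕ} {H : Hypercube d} → Point d → Diagonal H → Set ℓ
  _∈D_ {d} x D = ∃ λ k → ∀ i → Diagonal.pt D k i ≈ x i

  IsTransversal : {d : ℕ} {H : Hypercube d} → Diagonal H → Set ℓ
  IsTransversal {H = H} D = ∀ k l → H (Diagonal.pt D k) ≈ H (Diagonal.pt D l) → k ≡ l

  IsSuitable : {d : ℕ} {H : Hypercube d} → ℕ → Diagonal H → Set ℓ
  IsSuitable {H = H} d' D = sumFin n (λ k → Δ H (Diagonal.pt D k)) ≈ oneMinus·G₊ d'

  π : {d d' : ℕ} → d < d' → Point d' → Point d
  π d<d' x i = x (inject≤ i (<⇒≤ d<d'))

  extension : {d d' : ℕ} → d < d' → Hypercube d → Hypercube d'
  extension {d} {d'} d<d' L x =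
    L (π d<d' x) ∙ sumFin d' (λ j → if ⌊ d ≤? toℕ j ⌋ then x j else ε)

-- For an entry x of the extension, Δ_{L'}(x) = Δ_L(π x): the extra symbol
-- summand is cancelled by the extra coordinates.  Summing Δ over a diagonal of
-- L', each of whose d' coordinates runs through G, gives (Σ symbols) - d'·G₊;
-- so π of a transversal is (G,d')-suitable.  Conversely, lift a suitable
-- diagonal D of L through π α by giving the k-th entry the new coordinates
-- α_j + enum k - enum k₀, except for one coordinate y_k left free.  The symbols are
-- then a_k + y_k with Σ a = 0 by suitability, and Hall's theorem (1952) —
-- a sequence with zero sum in a finite abelian group is the sequence of
-- differences of two enumerations of the group — chooses y.
module Submission where

open import Defs
open import Algebra.Bundles using (AbelianGroup)
open import Data.Nat using (ℕ; _≤_; _<_)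
open import Data.Product using (Σ; _×_)
open import Function.Bundles using (_⇔_; mk⇔)

open import Data.Bool using (if_then_else_)
open import Data.Nat as ℕ using (zero; suc; z≤n; s≤s; pred; NonZero; _≤?_; _<?_)
import Data.Nat.Properties as ℕ
open import Data.Nat.GeneralisedArithmetic using (fold; fold-+)
open import Data.Fin as Fin using (Fin; toℕ; fromℕ<; inject≤; punchOut; _≟_)
open import Data.Fin.Properties
  using ( any?; pigeonhole; punchOut-injective; injective⇒≤; suc-injective; nonZeroIndex
        ; toℕ-injective; toℕ-fromℕ<; toℕ-inject≤; toℕ<n)
open import Data.Fin.Permutation using (Permutation; permutation)
open import Data.Product using (∃; _,_; proj₁; proj₂)
open import Data.Sum using (_⊎_; inj₁; inj₂)
open import Data.Unit.Polymorphic using (⊤)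
open import Function using (_∘_)
open import Function.Definitions using (Injective)
open import Level using (Level; _⊔_; 0ℓ)
open import Relation.Nullary using (¬_; yes; no; contradiction)
open import Relation.Nullary.Decidable using (⌊_⌋; ¬?; decidable-stable; does-⇔; isYes≗does; dec-false)
open import Relation.Unary using (Pred; Decidable)
open import Relation.Binary.PropositionalEquality as ≡ using (_≡_; _≢_)

injective⇒surjective : ∀ {m} {f : Fin m → Fin m} → Injective _≡_ _≡_ f → ∀ y → ∃ λ x → f x ≡ y
injective⇒surjective {suc m} {f} f-injective y with any? (λ x → f x ≟ y)
... | yes hit = hit
... | no miss = contradiction (injective⇒≤ punchOut∘f-injective) ℕ.1+n≰n
  where
  y≢f : ∀ x → y ≢ f x
  y≢f x y≡fx = miss (x , ≡.sym y≡fx)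
  punchOut∘f-injective : Injective _≡_ _≡_ (λ x → punchOut (y≢f x))
  punchOut∘f-injective eq = f-injective (punchOut-injective (y≢f _) (y≢f _) eq)

injective⇒permutation : ∀ {m} {f : Fin m → Fin m} → Injective _≡_ _≡_ f → Permutation m m
injective⇒permutation {f = f} f-injective =
  permutation f (proj₁ ∘ surjective) (proj₂ ∘ surjective) (λ x → f-injective (proj₂ (surjective (f x))))
  where
  surjective : ∀ y → ∃ λ x → f x ≡ y
  surjective = injective⇒surjective f-injective

fold-cancel : ∀ {m} {f : Fin m → Fin m} → Injective _≡_ _≡_ f →
              ∀ u {x y} → fold x f u ≡ fold y f u → x ≡ y
fold-cancel f-injective zero    eq = eq
fold-cancel f-injective (suc u) eq = fold-cancel f-injective u (f-injective eq)

fold-returns : ∀ {m} {f : Fin m → Fin m} → Injective _≡_ _≡_ f →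
               ∀ x → ∃ λ t → fold x f (suc t) ≡ x
fold-returns {m} {f} f-injective x with pigeonhole (ℕ.n<1+n m) (λ t → fold x f (toℕ t))
... | i , j , i<j , same = t , ≡.sym (fold-cancel f-injective (toℕ i) (begin
  fold x f (toℕ i)                    ≡⟨ same ⟩
  fold x f (toℕ j)                    ≡⟨ ≡.cong (fold x f) j≡i+1+t ⟩
  fold x f (toℕ i ℕ.+ suc t)          ≡⟨ fold-+ x f (toℕ i) ⟩
  fold (fold x f (suc t)) f (toℕ i)   ∎))
  where
  open ≡.≡-Reasoning
  t : ℕ
  t = toℕ j ℕ.∸ suc (toℕ i)
  j≡i+1+t : toℕ j ≡ toℕ i ℕ.+ suc t
  j≡i+1+t = ≡.trans (≡.sym (ℕ.m+[n∸m]≡n i<j)) (≡.sym (ℕ.+-suc (toℕ i) t))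

least-witness : ∀ {p} {P : Pred ℕ p} → Decidable P →
                ∀ {t} → P t → ∃ λ s → P s × (∀ u → u < s → ¬ P u)
least-witness P? {zero}  P0 = 0 , P0 , λ _ ()
least-witness P? {suc t} Pt with P? 0
... | yes P0 = 0 , P0 , λ _ ()
... | no ¬P0 with least-witness (P? ∘ suc) Pt
...   | s , Ps , below = suc s , Ps , λ { zero _ → ¬P0 ; (suc u) u<s → below u (ℕ.s<s⁻¹ u<s) }

inject≤-or-≥ : ∀ {d d'} (d≤d' : d ≤ d') (j : Fin d') →
               (∃ λ i → inject≤ i d≤d' ≡ j) ⊎ d ≤ toℕ j
inject≤-or-≥ {d} d≤d' j with toℕ j <? d
... | yes j<d = inj₁ (fromℕ< j<d , toℕ-injective (≡.trans (toℕ-inject≤ _ d≤d') (toℕ-fromℕ< j<d)))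
... | no  j≮d = inj₂ (ℕ.≮⇒≥ j≮d)

module Chain {ℓ} {n : ℕ} (S : Pred (Fin n) ℓ) {φ : Fin n → Fin n} (φ-injective : Injective _≡_ _≡_ φ)
             {p : Fin n} (p∉S : ¬ S p) (s : ℕ) (orbit-in-S : ∀ u → u < s → S (fold p φ (suc u))) where

  r : ℕ → Fin n
  r = fold p φ

  InChain : Pred (Fin n) 0ℓ
  InChain i = ∃ λ (t : Fin (suc s)) → r (toℕ t) ≡ i

  chain? : Decidable InChain
  chain? i = any? (λ t → r (toℕ t) ≟ i)

  r∈chain : ∀ {u} → u ≤ s → InChain (r u)
  r∈chain u≤s = fromℕ< (s≤s u≤s) , ≡.cong r (toℕ-fromℕ< (s≤s u≤s))

  p∈chain : InChain p
  p∈chain = r∈chain z≤n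

  chain-next : ∀ {i} → InChain i → i ≢ r s → InChain (φ i) × S (φ i)
  chain-next (t , ≡.refl) rt≢rs = r∈chain t<s , orbit-in-S (toℕ t) t<s
    where
    t<s : toℕ t < s
    t<s = ℕ.≤∧≢⇒< (ℕ.s≤s⁻¹ (toℕ<n t)) (rt≢rs ∘ ≡.cong r)

  close : Fin n → Fin n → Fin n
  close e i with chain? i | i ≟ r s | i ≟ e
  ... | yes _ | no _  | _     = φ i
  ... | yes _ | yes _ | _     = e
  ... | no _  | _     | yes _ = p
  ... | no _  | _     | no _  = i

  data CloseView (e i : Fin n) : Fin n → Set where
    along : InChain i → i ≢ r s → CloseView e i (φ i)
    last  : i ≡ r s → CloseView e i e
    back  : ¬ InChain i → i ≡ e → CloseView e i p
    fixed : ¬ InChain i → i ≢ e → CloseView e i i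

  close-view : ∀ e i → CloseView e i (close e i)
  close-view e i with chain? i | i ≟ r s | i ≟ e
  ... | yes i∈ | no i≢rs  | _       = along i∈ i≢rs
  ... | yes _  | yes i≡rs | _       = last i≡rs
  ... | no i∉  | _        | yes i≡e = back i∉ i≡e
  ... | no i∉  | _        | no i≢e  = fixed i∉ i≢e

  module _ {e : Fin n} (e∉S : ¬ S e) where

    views-apart : ∀ {i j x y} → CloseView e i x → CloseView e j y → x ≡ y → i ≡ j
    views-apart (along _ _)     (along _ _)   eq = φ-injective eq
    views-apart (along i∈ i≢rs) (last _)      eq =
      contradiction (≡.subst S eq (proj₂ (chain-next i∈ i≢rs))) e∉S
    views-apart (along i∈ i≢rs) (back _ _)    eq =
      contradiction (≡.subst S eq (proj₂ (chain-next i∈ i≢rs))) p∉S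
    views-apart (along i∈ i≢rs) (fixed j∉ _)  eq =
      contradiction (≡.subst InChain eq (proj₁ (chain-next i∈ i≢rs))) j∉
    views-apart (last i≡rs)     (last j≡rs)   _  = ≡.trans i≡rs (≡.sym j≡rs)
    views-apart (last _)        (back j∉ j≡e) eq =
      contradiction (≡.subst InChain (≡.sym (≡.trans j≡e eq)) p∈chain) j∉
    views-apart (last _)        (fixed _ j≢e) eq = contradiction (≡.sym eq) j≢e
    views-apart (back _ i≡e)    (back _ j≡e)  _  = ≡.trans i≡e (≡.sym j≡e)
    views-apart (back _ _)      (fixed j∉ _)  eq = contradiction (≡.subst InChain eq p∈chain) j∉
    views-apart (fixed _ _)     (fixed _ _)   eq = eq
    views-apart v@(last _)    w@(along _ _) eq = ≡.sym (views-apart w v (≡.sym eq))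
    views-apart v@(back _ _)  w@(along _ _) eq = ≡.sym (views-apart w v (≡.sym eq))
    views-apart v@(back _ _)  w@(last _)    eq = ≡.sym (views-apart w v (≡.sym eq))
    views-apart v@(fixed _ _) w@(along _ _) eq = ≡.sym (views-apart w v (≡.sym eq))
    views-apart v@(fixed _ _) w@(last _)    eq = ≡.sym (views-apart w v (≡.sym eq))
    views-apart v@(fixed _ _) w@(back _ _)  eq = ≡.sym (views-apart w v (≡.sym eq))

    close-injective : Injective _≡_ _≡_ (close e)
    close-injective {i} {j} = views-apart (close-view e i) (close-view e j)

  close-on-chain : ∀ {i} → InChain i → close (φ (r s)) i ≡ φ i
  close-on-chain {i} i∈ = go (close-view (φ (r s)) i)
    where
    go : ∀ {x} → CloseView (φ (r s)) i x → x ≡ φ i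
    go (along _ _)   = ≡.refl
    go (last ≡.refl) = ≡.refl
    go (back i∉ _)   = contradiction i∈ i∉
    go (fixed i∉ _)  = contradiction i∈ i∉

  close-off-chain : ∀ {e i} → ¬ InChain i → i ≢ e → close e i ≡ i
  close-off-chain {e} {i} i∉ i≢e = go (close-view e i)
    where
    go : ∀ {x} → CloseView e i x → x ≡ i
    go (along i∈ _)  = contradiction i∈ i∉
    go (last ≡.refl) = contradiction (r∈chain ℕ.≤-refl) i∉
    go (back _ i≡e)  = contradiction i≡e i≢e
    go (fixed _ _)   = ≡.refl

module GroupLemmas {g ℓ : Level} (G : AbelianGroup g ℓ) where
  open AbelianGroup G
  open import Algebra.Properties.AbelianGroup G
  open import Relation.Binary.Reasoning.Setoid setoid

  [x-yz]z≈x-y : ∀ x y z → (x - (y ∙ z)) ∙ z ≈ x - y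
  [x-yz]z≈x-y x y z = begin
    (x - (y ∙ z)) ∙ z        ≈⟨ ∙-congʳ (∙-congˡ (⁻¹-∙-comm y z)) ⟨
    (x ∙ (y ⁻¹ ∙ z ⁻¹)) ∙ z  ≈⟨ ∙-congʳ (assoc x (y ⁻¹) (z ⁻¹)) ⟨
    ((x - y) - z) ∙ z        ≈⟨ //-rightDividesˡ z (x - y) ⟩
    x - y                    ∎

  x-[x-y]≈y : ∀ x y → x - (x - y) ≈ y
  x-[x-y]≈y x y = begin
    x - (x - y)  ≈⟨ ∙-congˡ (⁻¹-anti-homo‿- x y) ⟩
    x ∙ (y - x)  ≈⟨ assoc x y (x ⁻¹) ⟨
    (x ∙ y) - x  ≈⟨ xyx⁻¹≈y x y ⟩
    y            ∎

  [xz]-[yz]≈x-y : ∀ x y z → (x ∙ z) - (y ∙ z) ≈ x - y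
  [xz]-[yz]≈x-y x y z = begin
    (x ∙ z) - (y ∙ z)        ≈⟨ ∙-congˡ (⁻¹-cong (comm y z)) ⟩
    (x ∙ z) - (z ∙ y)        ≈⟨ ∙-congˡ (⁻¹-∙-comm z y) ⟨
    (x ∙ z) ∙ (z ⁻¹ ∙ y ⁻¹)  ≈⟨ assoc _ _ _ ⟨
    ((x ∙ z) - z) - y        ≈⟨ ∙-congʳ (//-rightDividesʳ z x) ⟩
    x - y                    ∎

module HyperProperties {g ℓ : Level} (G : AbelianGroup g ℓ) {n : ℕ} (ord : HasOrder G n) where
  open AbelianGroup G
  open HasOrder ord
  open Hyper G ord
  open import Algebra.Properties.AbelianGroup G
  open import Algebra.Properties.CommutativeMonoid.Sum commutativeMonoid
    using (sum; sum-cong-≋; sum-cong-≗; ∑-distrib-+; ∑-comm; sum-permute)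
  open import Relation.Binary.Reasoning.Setoid setoid

  Injective≈ : (Fin n → Carrier) → Set ℓ
  Injective≈ f = ∀ k l → f k ≈ f l → k ≡ l

  Injective≈-resp : ∀ {f f′} → (∀ k → f k ≈ f′ k) → Injective≈ f → Injective≈ f′
  Injective≈-resp f≈f′ f-injective k l eq = f-injective k l (trans (f≈f′ k) (trans eq (sym (f≈f′ l))))

  index : Carrier → Fin n
  index g = proj₁ (enum-surj g)

  enum-index : ∀ g → enum (index g) ≈ g
  enum-index g = proj₂ (enum-surj g)

  index-injective : ∀ {f} → Injective≈ f → Injective _≡_ _≡_ (index ∘ f)
  index-injective {f} f-injective {k} {l} eq = f-injective k l (begin
    f k                ≈⟨ enum-index (f k) ⟨
    enum (index (f k)) ≡⟨ ≡.cong enum eq ⟩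
    enum (index (f l)) ≈⟨ enum-index (f l) ⟩
    f l                ∎)

  injective≈⇒surjective : ∀ {f} → Injective≈ f → ∀ g → ∃ λ k → f k ≈ g
  injective≈⇒surjective {f} f-injective g
    with k , eq ← injective⇒surjective (index-injective f-injective) (index g) = k , (begin
    f k                ≈⟨ enum-index (f k) ⟨
    enum (index (f k)) ≡⟨ ≡.cong enum eq ⟩
    enum (index g)     ≈⟨ enum-index g ⟩
    g                  ∎)

  sumFin≡sum : ∀ m (f : Fin m → Carrier) → sumFin m f ≡ sum f
  sumFin≡sum zero    f = ≡.refl
  sumFin≡sum (suc m) f = ≡.cong (f Fin.zero ∙_) (sumFin≡sum m (f ∘ Fin.suc))

  sumFin-cong : ∀ m {f g : Fin m → Carrier} → (∀ i → f i ≈ g i) → sumFin m f ≈ sumFin m g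
  sumFin-cong m {f} {g} f≈g rewrite sumFin≡sum m f | sumFin≡sum m g = sum-cong-≋ f≈g

  sumFin-∙ : ∀ m (f g : Fin m → Carrier) → sumFin m (λ i → f i ∙ g i) ≈ sumFin m f ∙ sumFin m g
  sumFin-∙ m f g rewrite sumFin≡sum m (λ i → f i ∙ g i) | sumFin≡sum m f | sumFin≡sum m g =
    ∑-distrib-+ f g

  sumFin-⁻¹ : ∀ m (f : Fin m → Carrier) → sumFin m (λ i → f i ⁻¹) ≈ sumFin m f ⁻¹
  sumFin-⁻¹ zero    f = sym ε⁻¹≈ε
  sumFin-⁻¹ (suc m) f = trans (∙-congˡ (sumFin-⁻¹ m (f ∘ Fin.suc))) (⁻¹-∙-comm _ _)

  sumFin-- : ∀ m (f g : Fin m → Carrier) → sumFin m (λ i → f i - g i) ≈ sumFin m f - sumFin m g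
  sumFin-- m f g = trans (sumFin-∙ m f (λ i → g i ⁻¹)) (∙-congˡ (sumFin-⁻¹ m g))

  sumFin-const : ∀ m g → sumFin m (λ _ → g) ≈ mulℕ m g
  sumFin-const zero    g = refl
  sumFin-const (suc m) g = ∙-congˡ (sumFin-const m g)

  sumFin-comm : ∀ m m' (f : Fin m → Fin m' → Carrier) →
                sumFin m (λ i → sumFin m' (f i)) ≈ sumFin m' (λ j → sumFin m (λ i → f i j))
  sumFin-comm m m' f = begin
    sumFin m (λ i → sumFin m' (f i))          ≡⟨ sumFin≡sum m _ ⟩
    sum (λ i → sumFin m' (f i))               ≡⟨ sum-cong-≗ (λ i → sumFin≡sum m' (f i)) ⟩
    sum (λ i → sum (f i))                     ≈⟨ ∑-comm f ⟩
    sum (λ j → sum (λ i → f i j))             ≡⟨ sum-cong-≗ (λ j → sumFin≡sum m (λ i → f i j)) ⟨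
    sum (λ j → sumFin m (λ i → f i j))        ≡⟨ sumFin≡sum m' _ ⟨
    sumFin m' (λ j → sumFin m (λ i → f i j))  ∎

  sumFin-ε : ∀ m {f : Fin m → Carrier} → (∀ i → f i ≈ ε) → sumFin m f ≈ ε
  sumFin-ε zero    f≈ε = refl
  sumFin-ε (suc m) f≈ε = trans (∙-cong (f≈ε Fin.zero) (sumFin-ε m (f≈ε ∘ Fin.suc))) (identityʳ ε)

  sumFin-single : ∀ m (f : Fin m → Carrier) (l : Fin m) → (∀ i → i ≢ l → f i ≈ ε) →
                  sumFin m f ≈ f l
  sumFin-single (suc m) f Fin.zero    f≈ε =
    trans (∙-congˡ (sumFin-ε m λ i → f≈ε (Fin.suc i) λ ())) (identityʳ _)
  sumFin-single (suc m) f (Fin.suc l) f≈ε =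
    trans (∙-cong (f≈ε Fin.zero λ ())
                  (sumFin-single m (f ∘ Fin.suc) l λ i i≢l → f≈ε (Fin.suc i) (i≢l ∘ suc-injective)))
          (identityˡ _)

  injective⇒sumFin≈G₊ : ∀ {f} → Injective≈ f → sumFin n f ≈ G₊
  injective⇒sumFin≈G₊ {f} f-injective = begin
    sumFin n f                   ≈⟨ sumFin-cong n (λ k → enum-index (f k)) ⟨
    sumFin n (enum ∘ index ∘ f)  ≡⟨ sumFin≡sum n _ ⟩
    sum (enum ∘ index ∘ f)       ≈⟨ sum-permute enum (injective⇒permutation (index-injective f-injective)) ⟨
    sum enum                     ≡⟨ sumFin≡sum n enum ⟨
    G₊                           ∎

  sumFin-coordinates : ∀ m (x : Fin n → Point m) → (∀ j → Injective≈ (λ k → x k j)) →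
                       sumFin n (λ k → sumFin m (x k)) ≈ mulℕ m G₊
  sumFin-coordinates m x x-injective = begin
    sumFin n (λ k → sumFin m (x k))          ≈⟨ sumFin-comm n m x ⟩
    sumFin m (λ j → sumFin n (λ k → x k j))  ≈⟨ sumFin-cong m (injective⇒sumFin≈G₊ ∘ x-injective) ⟩
    sumFin m (λ _ → G₊)                      ≈⟨ sumFin-const m G₊ ⟩
    mulℕ m G₊                                ∎

  sumFin-split : ∀ {e e'} (e≤e' : e ≤ e') (x : Fin e' → Carrier) →
                 sumFin e' x ≈ sumFin e (λ i → x (inject≤ i e≤e'))
                             ∙ sumFin e' (λ j → if ⌊ e ≤? toℕ j ⌋ then x j else ε)
  sumFin-split {zero}              _             x = sym (identityˡ _)
  sumFin-split {suc e} {suc e'} e≤e'@(s≤s e≤e″) x = begin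
    x₀ ∙ sumFin e' (x ∘ Fin.suc)  ≈⟨ ∙-congˡ (sumFin-split e≤e″ (x ∘ Fin.suc)) ⟩
    x₀ ∙ (old ∙ new)              ≈⟨ assoc _ _ _ ⟨
    x₀ ∙ old ∙ new                ≈⟨ ∙-congˡ (sumFin-cong e' (reflexive ∘ mask-suc)) ⟩
    x₀ ∙ old ∙ new′               ≈⟨ ∙-congˡ (identityˡ _) ⟨
    x₀ ∙ old ∙ (ε ∙ new′)         ∎
    where
    x₀ old new new′ : Carrier
    x₀   = x Fin.zero
    old  = sumFin e (λ i → x (Fin.suc (inject≤ i e≤e″)))
    new  = sumFin e' (λ j → if ⌊ e ≤? toℕ j ⌋ then x (Fin.suc j) else ε)
    new′ = sumFin e' (λ j → if ⌊ suc e ≤? suc (toℕ j) ⌋ then x (Fin.suc j) else ε)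
    mask-suc : ∀ j → (if ⌊ e ≤? toℕ j ⌋ then x (Fin.suc j) else ε)
                   ≡ (if ⌊ suc e ≤? suc (toℕ j) ⌋ then x (Fin.suc j) else ε)
    mask-suc j = ≡.cong (λ b → if b then x (Fin.suc j) else ε)
      (≡.trans (isYes≗does (e ≤? toℕ j))
      (≡.trans (does-⇔ (mk⇔ s≤s ℕ.s≤s⁻¹) (e ≤? toℕ j) (suc e ≤? suc (toℕ j)))
               (≡.sym (isYes≗does _))))

  update-≢ : ∀ {m} (x : Point m) {i j} g → j ≢ i → update x i g j ≡ x j
  update-≢ x {i} {j} g j≢i =
    ≡.cong (λ b → if b then g else x j) (≡.trans (isYes≗does (j ≟ i)) (dec-false (j ≟ i) j≢i))

  sumFin-update : ∀ m (x : Fin m → Carrier) j g → sumFin m (update x j g) ≈ (sumFin m x - x j) ∙ g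
  sumFin-update (suc m) x Fin.zero    g = begin
    g ∙ sumFin m (x ∘ Fin.suc)                                ≈⟨ comm _ _ ⟩
    sumFin m (x ∘ Fin.suc) ∙ g                                ≈⟨ ∙-congʳ (xyx⁻¹≈y (x Fin.zero) _) ⟨
    (x Fin.zero ∙ sumFin m (x ∘ Fin.suc) - x Fin.zero) ∙ g   ∎
  sumFin-update (suc m) x (Fin.suc j) g = begin
    x Fin.zero ∙ sumFin m (update x (Fin.suc j) g ∘ Fin.suc)
      ≈⟨ ∙-congˡ (sumFin-cong m (reflexive ∘ update-suc)) ⟩
    x Fin.zero ∙ sumFin m (update (x ∘ Fin.suc) j g)
      ≈⟨ ∙-congˡ (sumFin-update m (x ∘ Fin.suc) j g) ⟩
    x Fin.zero ∙ ((sumFin m (x ∘ Fin.suc) - x (Fin.suc j)) ∙ g)  ≈⟨ assoc _ _ _ ⟨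
    x Fin.zero ∙ (sumFin m (x ∘ Fin.suc) - x (Fin.suc j)) ∙ g    ≈⟨ ∙-congʳ (assoc _ _ _) ⟨
    (x Fin.zero ∙ sumFin m (x ∘ Fin.suc) - x (Fin.suc j)) ∙ g    ∎
    where
    update-suc : ∀ i → update x (Fin.suc j) g (Fin.suc i) ≡ update (x ∘ Fin.suc) j g i
    update-suc i = ≡.cong (λ b → if b then g else x (Fin.suc i))
                          (≡.trans (isYes≗does _) (≡.sym (isYes≗does (i ≟ j))))

  Δ-cong : ∀ {m} {H : Hypercube m} → Respects≈ H →
           ∀ {x y : Point m} → (∀ i → x i ≈ y i) → Δ H x ≈ Δ H y
  Δ-cong {m} H-resp x≈y = ∙-cong (H-resp _ _ x≈y) (⁻¹-cong (sumFin-cong m x≈y))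

module Hall {g ℓ : Level} (G : AbelianGroup g ℓ) {n : ℕ} (ord : HasOrder G n)
            (a : Fin n → AbelianGroup.Carrier G) where
  open AbelianGroup G
  open HasOrder ord
  open Hyper G ord
  open HyperProperties G ord
  open GroupLemmas G
  open import Algebra.Properties.AbelianGroup G
  open import Relation.Binary.Reasoning.Setoid setoid

  record Realisation {ℓ′} (S : Pred (Fin n) ℓ′) : Set (g ⊔ ℓ ⊔ ℓ′) where
    field
      b c         : Fin n → Carrier
      b-injective : Injective≈ b
      c-injective : Injective≈ c
      realises    : ∀ {i} → S i → c i ≈ b i ∙ a i

  restrict : ∀ {ℓ₁ ℓ₂} {S : Pred (Fin n) ℓ₁} {S′ : Pred (Fin n) ℓ₂} →
             (∀ {i} → S′ i → S i) → Realisation S → Realisation S′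
  restrict S′⊆S R = record { Realisation R; realises = Realisation.realises R ∘ S′⊆S }

  -- Hall's exchange: follow φ (where b (φ i) ∙ c i = K) from p until the chain
  -- leaves S, then rotate b forward along the chain and c backward, using the
  -- spare position q to close up the cycle of c.
  module Step {ℓ′} {S : Pred (Fin n) ℓ′} (S? : Decidable S) {p q : Fin n}
              (p∉S : ¬ S p) (q∉S : ¬ S q) (p≢q : p ≢ q) (R : Realisation S) where
    open Realisation R

    -- K is chosen so that the new pair at p, namely b (φ p) and c q, realises a p.
    K : Carrier
    K = (c q - a p) ∙ c p

    φ : Fin n → Fin n
    φ i = proj₁ (injective≈⇒surjective b-injective (K - c i))

    b∘φ : ∀ i → b (φ i) ≈ K - c i
    b∘φ i = proj₂ (injective≈⇒surjective b-injective (K - c i))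

    φ-injective : Injective _≡_ _≡_ φ
    φ-injective {i} {j} eq = c-injective i j (⁻¹-injective (∙-cancelˡ K _ _ (begin
      K - c i   ≈⟨ b∘φ i ⟨
      b (φ i)   ≡⟨ ≡.cong b eq ⟩
      b (φ j)   ≈⟨ b∘φ j ⟩
      K - c j   ∎)))

    exit-exists : ∃ λ s → ¬ S (fold p φ (suc s)) × (∀ u → u < s → S (fold p φ (suc u)))
    exit-exists with t , returns ← fold-returns φ-injective p
                with s , exits , below ← least-witness (λ u → ¬? (S? (fold p φ (suc u)))) {t}
                                                       (λ S-rt → p∉S (≡.subst S returns S-rt))
      = s , exits , λ u u<s → decidable-stable (S? _) (below u u<s)

    module Closing (s : ℕ) (exit∉S : ¬ S (fold p φ (suc s)))
                   (orbit-in-S : ∀ u → u < s → S (fold p φ (suc u))) where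
      open Chain S φ-injective p∉S s orbit-in-S

      σ : Fin n → Fin n
      σ = close (r (suc s))

      ρ : Fin n → Fin n
      ρ = close q

      χ : Fin n → Fin n
      χ i = proj₁ (injective⇒surjective (close-injective q∉S) i)

      ρ∘χ : ∀ i → ρ (χ i) ≡ i
      ρ∘χ i = proj₂ (injective⇒surjective (close-injective q∉S) i)

      χ-injective : Injective _≡_ _≡_ χ
      χ-injective {i} {j} eq = ≡.trans (≡.sym (ρ∘χ i)) (≡.trans (≡.cong ρ eq) (ρ∘χ j))

      realises-along : ∀ {j} → S (φ j) → c j ≈ b (φ (φ j)) ∙ a (φ j)
      realises-along {j} φj∈S = sym (begin
        b (φ (φ j)) ∙ a (φ j)                ≈⟨ ∙-congʳ (b∘φ (φ j)) ⟩
        (K - c (φ j)) ∙ a (φ j)              ≈⟨ ∙-congʳ (∙-congˡ (⁻¹-cong (realises φj∈S))) ⟩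
        (K - (b (φ j) ∙ a (φ j))) ∙ a (φ j)  ≈⟨ [x-yz]z≈x-y K (b (φ j)) (a (φ j)) ⟩
        K - b (φ j)                          ≈⟨ ∙-congˡ (⁻¹-cong (b∘φ j)) ⟩
        K - (K - c j)                        ≈⟨ x-[x-y]≈y K (c j) ⟩
        c j                                  ∎)

      realises-p : c q ≈ b (φ p) ∙ a p
      realises-p = sym (begin
        b (φ p) ∙ a p                    ≈⟨ ∙-congʳ (b∘φ p) ⟩
        ((c q - a p) ∙ c p - c p) ∙ a p  ≈⟨ ∙-congʳ (//-rightDividesʳ (c p) (c q - a p)) ⟩
        (c q - a p) ∙ a p                ≈⟨ //-rightDividesˡ (a p) (c q) ⟩
        c q                              ∎)

      realises-at : ∀ j → S (ρ j) ⊎ ρ j ≡ p → c j ≈ b (σ (ρ j)) ∙ a (ρ j)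
      realises-at j = go (close-view q j)
        where
        b∘σ : ∀ {x y} → σ x ≡ y → b (σ x) ≈ b y
        b∘σ = reflexive ∘ ≡.cong b
        go : ∀ {x} → CloseView q j x → S x ⊎ x ≡ p → c j ≈ b (σ x) ∙ a x
        go (along j∈ j≢rs) _ with φj∈ , φj∈S ← chain-next j∈ j≢rs =
          trans (realises-along φj∈S) (∙-congʳ (sym (b∘σ (close-on-chain φj∈))))
        go (last _)        (inj₁ q∈S)    = contradiction q∈S q∉S
        go (last _)        (inj₂ q≡p)    = contradiction (≡.sym q≡p) p≢q
        go (back _ ≡.refl) _             = trans realises-p (∙-congʳ (sym (b∘σ (close-on-chain p∈chain))))
        go (fixed j∉ _)    (inj₁ j∈S)    =
          trans (realises j∈S) (∙-congʳ (sym (b∘σ (close-off-chain j∉ λ { ≡.refl → exit∉S j∈S }))))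
        go (fixed j∉ _)    (inj₂ ≡.refl) = contradiction p∈chain j∉

      extended : Realisation (λ i → S i ⊎ i ≡ p)
      extended = record
        { b           = b ∘ σ
        ; c           = c ∘ χ
        ; b-injective = λ i j → close-injective exit∉S ∘ b-injective (σ i) (σ j)
        ; c-injective = λ i j → χ-injective ∘ c-injective (χ i) (χ j)
        ; realises    = λ {i} i∈ →
            ≡.subst (λ x → c (χ i) ≈ b (σ x) ∙ a x) (ρ∘χ i)
                    (realises-at (χ i) (≡.subst (λ x → S x ⊎ x ≡ p) (≡.sym (ρ∘χ i)) i∈))
        }

    extended : Realisation (λ i → S i ⊎ i ≡ p)
    extended with s , exit∉S , orbit-in-S ← exit-exists = Closing.extended s exit∉S orbit-in-S

  complete : ∀ {ℓ′} {S : Pred (Fin n) ℓ′} (q : Fin n) → (∀ i → i ≢ q → S i) →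
             sumFin n a ≈ ε → Realisation S → Realisation (λ _ → ⊤ {ℓ = 0ℓ})
  complete q off-q⊆S Σa≈ε R = record { Realisation R; realises = λ {i} _ → realises-everywhere i }
    where
    open Realisation R
    defect : Fin n → Carrier
    defect i = c i - (b i ∙ a i)
    Σdefect≈ε : sumFin n defect ≈ ε
    Σdefect≈ε = begin
      sumFin n defect                          ≈⟨ sumFin-- n c (λ i → b i ∙ a i) ⟩
      sumFin n c - sumFin n (λ i → b i ∙ a i)
        ≈⟨ ∙-cong (injective⇒sumFin≈G₊ c-injective) (⁻¹-cong (sumFin-∙ n b a)) ⟩
      G₊ - (sumFin n b ∙ sumFin n a)
        ≈⟨ ∙-congˡ (⁻¹-cong (∙-cong (injective⇒sumFin≈G₊ b-injective) Σa≈ε)) ⟩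
      G₊ - (G₊ ∙ ε)                            ≈⟨ ∙-congˡ (⁻¹-cong (identityʳ G₊)) ⟩
      G₊ - G₊                                  ≈⟨ inverseʳ G₊ ⟩
      ε                                        ∎
    realises-everywhere : ∀ i → c i ≈ b i ∙ a i
    realises-everywhere i with i ≟ q
    ... | no i≢q     = realises (off-q⊆S i i≢q)
    ... | yes ≡.refl = x∙y⁻¹≈ε⇒x≈y _ _ (trans (sym (sumFin-single n defect i defect≈ε)) Σdefect≈ε)
      where
      defect≈ε : ∀ j → j ≢ i → defect j ≈ ε
      defect≈ε j j≢i = x≈y⇒x∙y⁻¹≈ε (realises (off-q⊆S j j≢i))

  hall : .{{NonZero n}} → sumFin n a ≈ ε → Realisation (λ _ → ⊤ {ℓ = 0ℓ})
  hall Σa≈ε = complete last below-last Σa≈ε (build (pred n) ℕ.≤-refl)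
    where
    m<n : pred n < n
    m<n = ℕ.m≤pred[n]⇒suc[m]≤n ℕ.≤-refl
    last : Fin n
    last = fromℕ< m<n
    below-last : ∀ i → i ≢ last → toℕ i < pred n
    below-last i i≢last = ℕ.≤∧≢⇒< (ℕ.suc[m]≤n⇒m≤pred[n] (toℕ<n i))
                                  (λ eq → i≢last (toℕ-injective (≡.trans eq (≡.sym (toℕ-fromℕ< m<n)))))
    initial : Realisation (λ i → toℕ i < 0)
    initial = record { b = enum ; c = enum ; b-injective = enum-inj ; c-injective = enum-inj ; realises = λ () }
    build : ∀ k → k ≤ pred n → Realisation (λ i → toℕ i < k)
    build zero    _   = initial
    build (suc k) k<m =
      restrict below-suc (Step.extended (λ i → toℕ i <? k) p∉S q∉S p≢q (build k (ℕ.<⇒≤ k<m)))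
      where
      p : Fin n
      p = fromℕ< (ℕ.<-trans k<m m<n)
      toℕ-p : toℕ p ≡ k
      toℕ-p = toℕ-fromℕ< _
      p∉S : ¬ toℕ p < k
      p∉S = ℕ.<-irrefl toℕ-p
      q∉S : ¬ toℕ last < k
      q∉S lt = ℕ.<-asym k<m (≡.subst (_< k) (toℕ-fromℕ< m<n) lt)
      p≢q : p ≢ last
      p≢q eq = ℕ.<⇒≢ k<m (≡.trans (≡.sym toℕ-p) (≡.trans (≡.cong toℕ eq) (toℕ-fromℕ< m<n)))
      below-suc : ∀ {i} → toℕ i < suc k → toℕ i < k ⊎ i ≡ p
      below-suc {i} i<1+k with ℕ.m≤n⇒m<n∨m≡n (ℕ.s≤s⁻¹ i<1+k)
      ... | inj₁ i<k = inj₁ i<k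
      ... | inj₂ i≡k = inj₂ (toℕ-injective (≡.trans i≡k (≡.sym toℕ-p)))

  hall-through : sumFin n a ≈ ε → (k₀ : Fin n) (g₀ : Carrier) →
                 ∃ λ y → Injective≈ y × Injective≈ (λ k → a k ∙ y k) × y k₀ ≈ g₀
  hall-through Σa≈ε k₀ g₀ = y , y-injective , ay-injective , y-k₀
    where
    open Realisation (hall {{nonZeroIndex k₀}} Σa≈ε)
    t : Carrier
    t = g₀ - b k₀
    y : Fin n → Carrier
    y k = b k ∙ t
    y-injective : Injective≈ y
    y-injective k l = b-injective k l ∘ ∙-cancelʳ t _ _
    ct≈ay : ∀ k → c k ∙ t ≈ a k ∙ y k
    ct≈ay k = begin
      c k ∙ t          ≈⟨ ∙-congʳ (trans (realises _) (comm _ _)) ⟩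
      a k ∙ b k ∙ t    ≈⟨ assoc _ _ _ ⟩
      a k ∙ (b k ∙ t)  ∎
    ay-injective : Injective≈ (λ k → a k ∙ y k)
    ay-injective = Injective≈-resp ct≈ay (λ k l → c-injective k l ∘ ∙-cancelʳ t _ _)
    y-k₀ : y k₀ ≈ g₀
    y-k₀ = trans (sym (assoc _ _ _)) (xyx⁻¹≈y (b k₀) g₀)

module Extension {g ℓ : Level} (G : AbelianGroup g ℓ) {n : ℕ} (ord : HasOrder G n) {d d' : ℕ} (d<d' : d < d')
                 (L : Hyper.Hypercube G ord d) (L-resp : Hyper.Respects≈ G ord L) where
  open AbelianGroup G
  open HasOrder ord
  open Hyper G ord
  open HyperProperties G ord
  open GroupLemmas G
  open import Algebra.Properties.AbelianGroup G
  open import Relation.Binary.Reasoning.Setoid setoid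

  d≤d' : d ≤ d'
  d≤d' = ℕ.<⇒≤ d<d'

  L' : Hypercube d'
  L' = extension d<d' L

  Δ-extension : ∀ x → Δ L' x ≈ Δ L (π d<d' x)
  Δ-extension x = begin
    (L (π d<d' x) ∙ new) - sumFin d' x                  ≈⟨ ∙-congˡ (⁻¹-cong (sumFin-split d≤d' x)) ⟩
    (L (π d<d' x) ∙ new) - (sumFin d (π d<d' x) ∙ new)  ≈⟨ [xz]-[yz]≈x-y _ _ new ⟩
    L (π d<d' x) - sumFin d (π d<d' x)                  ∎
    where
    new : Carrier
    new = sumFin d' (λ j → if ⌊ d ≤? toℕ j ⌋ then x j else ε)

  L'≈Δ∙sum : ∀ x → L' x ≈ Δ L (π d<d' x) ∙ sumFin d' x
  L'≈Δ∙sum x = trans (sym (//-rightDividesˡ (sumFin d' x) (L' x))) (∙-congʳ (Δ-extension x))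

  extension-update : ∀ {j} → d ≤ toℕ j → ∀ x g → L' (update x j g) ≈ (L' x - x j) ∙ g
  extension-update {j} d≤j x g = begin
    L' (update x j g)                                       ≈⟨ L'≈Δ∙sum (update x j g) ⟩
    Δ L (π d<d' (update x j g)) ∙ sumFin d' (update x j g)
      ≈⟨ ∙-cong (Δ-cong L-resp (reflexive ∘ π-update)) (sumFin-update d' x j g) ⟩
    Δ L (π d<d' x) ∙ ((sumFin d' x - x j) ∙ g)              ≈⟨ assoc _ _ _ ⟨
    Δ L (π d<d' x) ∙ (sumFin d' x - x j) ∙ g                ≈⟨ ∙-congʳ (assoc _ _ _) ⟨
    (Δ L (π d<d' x) ∙ sumFin d' x - x j) ∙ g                ≈⟨ ∙-congʳ (∙-congʳ (L'≈Δ∙sum x)) ⟨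
    (L' x - x j) ∙ g                                        ∎
    where
    π-update : ∀ i → π d<d' (update x j g) i ≡ π d<d' x i
    π-update i = update-≢ x g λ eq → ℕ.<⇒≱ (toℕ<n i)
      (≡.subst (d ≤_) (≡.trans (≡.cong toℕ (≡.sym eq)) (toℕ-inject≤ i d≤d')) d≤j)

  sumFin-Δ∘π : (x : Fin n → Point d') → (∀ j → Injective≈ (λ k → x k j)) →
            sumFin n (λ k → Δ L (π d<d' (x k))) ≈ sumFin n (L' ∘ x) - mulℕ d' G₊
  sumFin-Δ∘π x x-injective = begin
    sumFin n (λ k → Δ L (π d<d' (x k)))                    ≈⟨ sumFin-cong n (sym ∘ Δ-extension ∘ x) ⟩
    sumFin n (λ k → L' (x k) - sumFin d' (x k))            ≈⟨ sumFin-- n _ _ ⟩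
    sumFin n (L' ∘ x) - sumFin n (λ k → sumFin d' (x k))
      ≈⟨ ∙-congˡ (⁻¹-cong (sumFin-coordinates d' x x-injective)) ⟩
    sumFin n (L' ∘ x) - mulℕ d' G₊                         ∎

  π-diagonal : 1 ≤ d → Diagonal L' → Diagonal L
  π-diagonal 1≤d T = record
    { pt        = π d<d' ∘ T.pt
    ; distinct  = λ k l same → T.coord-inj (inject≤ i₀ d≤d') k l (same i₀)
    ; coord-inj = λ i → T.coord-inj (inject≤ i d≤d')
    }
    where
    module T = Diagonal T
    i₀ : Fin d
    i₀ = fromℕ< 1≤d

  transversal⇒suitable : 1 ≤ d → ∀ α → Σ (Diagonal L') (λ T → IsTransversal T × α ∈D T) →
                         Σ (Diagonal L) (λ D → IsSuitable d' D × π d<d' α ∈D D)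
  transversal⇒suitable 1≤d α (T , T-transversal , k₀ , T∋α) =
    π-diagonal 1≤d T ,
    trans (sumFin-Δ∘π T.pt T.coord-inj) (∙-congʳ (injective⇒sumFin≈G₊ T-transversal)) ,
    k₀ , T∋α ∘ (λ i → inject≤ i d≤d')
    where module T = Diagonal T

  lift : Point d → (Fin d' → Carrier) → Point d'
  lift x z j with toℕ j <? d
  ... | yes j<d = x (fromℕ< j<d)
  ... | no  _   = z j

  π-lift : ∀ x z i → π d<d' (lift x z) i ≡ x i
  π-lift x z i with toℕ (inject≤ i d≤d') <? d
  ... | yes j<d = ≡.cong x (toℕ-injective (≡.trans (toℕ-fromℕ< j<d) (toℕ-inject≤ i d≤d')))
  ... | no  j≮d = contradiction (≡.subst (_< d) (≡.sym (toℕ-inject≤ i d≤d')) (toℕ<n i)) j≮d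

  lift-new : ∀ x z {j} → d ≤ toℕ j → lift x z j ≡ z j
  lift-new x z {j} d≤j with toℕ j <? d
  ... | yes j<d = contradiction j<d (ℕ.≤⇒≯ d≤j)
  ... | no  _   = ≡.refl

  module Lift (α : Point d') (D : Diagonal L) (k₀ : Fin n)
              (D∋πα : ∀ i → Diagonal.pt D k₀ i ≈ π d<d' α i) where
    module D = Diagonal D

    base : Fin n → Point d'
    base k = lift (D.pt k) (λ j → enum k ∙ α j - enum k₀)

    π-base : ∀ k i → π d<d' (base k) i ≈ D.pt k i
    π-base k i = reflexive (π-lift _ _ i)

    base-injective : ∀ j → Injective≈ (λ k → base k j)
    base-injective j with inject≤-or-≥ d≤d' j
    ... | inj₁ (i , ≡.refl) = Injective≈-resp (λ k → sym (π-base k i)) (D.coord-inj i)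
    ... | inj₂ d≤j = Injective≈-resp (λ k → reflexive (≡.sym (lift-new _ _ d≤j)))
                       (λ k l → enum-inj k l ∘ ∙-cancelʳ (α j) _ _ ∘ ∙-cancelʳ (enum k₀ ⁻¹) _ _)

    base-k₀ : ∀ j → base k₀ j ≈ α j
    base-k₀ j with inject≤-or-≥ d≤d' j
    ... | inj₁ (i , ≡.refl) = trans (π-base k₀ i) (D∋πα i)
    ... | inj₂ d≤j = trans (reflexive (lift-new _ _ d≤j)) (xyx⁻¹≈y (enum k₀) (α j))

    j₀ : Fin d'
    j₀ = fromℕ< d<d'

    d≤j₀ : d ≤ toℕ j₀
    d≤j₀ = ℕ.≤-reflexive (≡.sym (toℕ-fromℕ< d<d'))

    a : Fin n → Carrier
    a k = L' (base k) - base k j₀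

    module _ (suitable : IsSuitable d' D) where

      sumFin-L'∘base : sumFin n (L' ∘ base) ≈ G₊
      sumFin-L'∘base = ∙-cancelʳ (mulℕ d' G₊ ⁻¹) _ _ (begin
        sumFin n (L' ∘ base) - mulℕ d' G₊        ≈⟨ sumFin-Δ∘π base base-injective ⟨
        sumFin n (λ k → Δ L (π d<d' (base k)))  ≈⟨ sumFin-cong n (Δ-cong L-resp ∘ π-base) ⟩
        sumFin n (λ k → Δ L (D.pt k))           ≈⟨ suitable ⟩
        G₊ - mulℕ d' G₊                         ∎)

      sumFin-a : sumFin n a ≈ ε
      sumFin-a = begin
        sumFin n a                                         ≈⟨ sumFin-- n _ _ ⟩
        sumFin n (L' ∘ base) - sumFin n (λ k → base k j₀)
          ≈⟨ ∙-cong sumFin-L'∘base (⁻¹-cong (injective⇒sumFin≈G₊ (base-injective j₀))) ⟩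
        G₊ - G₊                                            ≈⟨ inverseʳ G₊ ⟩
        ε                                                  ∎

    module _ {y : Fin n → Carrier} (y-injective : Injective≈ y)
             (ay-injective : Injective≈ (λ k → a k ∙ y k)) (y-k₀ : y k₀ ≈ α j₀) where

      point : Fin n → Point d'
      point k = update (base k) j₀ (y k)

      point-injective : ∀ j → Injective≈ (λ k → point k j)
      point-injective j with j ≟ j₀
      ... | yes ≡.refl = y-injective
      ... | no  _      = base-injective j

      lifted : Diagonal L'
      lifted = record
        { pt        = point
        ; distinct  = λ k l same → point-injective j₀ k l (same j₀)
        ; coord-inj = point-injective
        }

      lifted-transversal : IsTransversal lifted
      lifted-transversal = Injective≈-resp (λ k → sym (extension-update d≤j₀ (base k) (y k))) ay-injective

      point-k₀ : ∀ j → point k₀ j ≈ α j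
      point-k₀ j with j ≟ j₀
      ... | yes ≡.refl = y-k₀
      ... | no  _      = base-k₀ j

    -- Hall's solution is consumed by a function, not by `with`, which would make
    -- the type checker unfold its (huge) definition.
    transversal : IsSuitable d' D → Σ (Diagonal L') (λ T → IsTransversal T × α ∈D T)
    transversal suitable = lift-through (Hall.hall-through G ord a (sumFin-a suitable) k₀ (α j₀))
      where
      lift-through : (∃ λ y → Injective≈ y × Injective≈ (λ k → a k ∙ y k) × y k₀ ≈ α j₀) →
                     Σ (Diagonal L') (λ T → IsTransversal T × α ∈D T)
      lift-through (y , y-injective , ay-injective , y-k₀) =
        lifted y-injective ay-injective y-k₀ , lifted-transversal y-injective ay-injective y-k₀ ,
        k₀ , point-k₀ y-injective ay-injective y-k₀

  suitable⇒transversal : ∀ α → Σ (Diagonal L) (λ D → IsSuitable d' D × π d<d' α ∈D D) →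
                         Σ (Diagonal L') (λ T → IsTransversal T × α ∈D T)
  suitable⇒transversal α (D , suitable , k₀ , D∋πα) = Lift.transversal α D k₀ D∋πα suitable

theorem3p2 : ∀ {c ℓ} (G : AbelianGroup c ℓ) (n : ℕ) (ord : HasOrder G n)
    (d d' : ℕ) → 1 ≤ d → (d<d' : d < d')
    (L : Hyper.Hypercube G ord d) → Hyper.Respects≈ G ord L → Hyper.IsLatin G ord L →
    (α : Hyper.Point G ord d') →
    (Σ (Hyper.Diagonal G ord (Hyper.extension G ord d<d' L)) (λ T →
        Hyper.IsTransversal G ord T × Hyper._∈D_ G ord α T))
    ⇔
    (Σ (Hyper.Diagonal G ord L) (λ D →
        Hyper.IsSuitable G ord d' D × Hyper._∈D_ G ord (Hyper.π G ord d<d' α) D))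
theorem3p2 G n ord d d' 1≤d d<d' L L-resp _ α =
  mk⇔ (transversal⇒suitable 1≤d α) (suitable⇒transversal α)
  where open Extension G ord d<d' L L-resp
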